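{- Let $\mathcal H$ be an $(r,t)$-graph, let $e_1,e_2\in E(\mathcal H)$, and set $t'=|e_1\cap e_2|$ (so $t'\ge t$). Then \[ \tau(\mathcal H)\le \begin{cases} \left\lfloor \frac{r-t'}{2}\right\rfloor + t'-t+1 & \text{if } r-2t+1\le t'\le r,\\[2pt] 2r-4t-t'+2 & \text{if } t\le t'\le r-2t. \end{cases} \]
   Context: All hypergraphs are finite. An $r$-uniform hypergraph $\mathcal H$ is $r$-partite if its vertex set can be partitioned as $V(\mathcal H)=P_1\sqcup\dots\sqcup P_r$ such that $|e\cap P_j|=1$ for every edge $e$ and every $j\in[r]$. It is $t$-intersecting if $|e\cap f|\ge t$ for all $e,f\in E(\mathcal H)$. An $(r,t)$-graph is an $r$-uniform, $r$-partite, $t$-intersecting hypergraph. A cover of $\mathcal H$ is a set $C\subseteq V(\mathcal H)$ with $C\cap e\neq\emptyset$ for every edge $e$; the cover number $\tau(\mathcal H)$ is the minimum size of a cover. -}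

module Defs where

open import Data.Nat using (ℕ; _≤_)
open import Data.Fin using (Fin)
open import Data.Fin.Subset using (Subset; _∈_; _∩_; ∣_∣; Nonempty)
open import Data.List using (List)
import Data.List.Membership.Propositional as L
open import Data.Product using (Σ; _×_)
open import Relation.Binary.PropositionalEquality using (_≡_)

-- A finite hypergraph on vertex set Fin n together with a partition of the
-- vertices into r (possibly empty) classes P_j = { v | part v ≡ j }.
-- The edge set is given as a list of vertex subsets.
record PartHypergraph (r : ℕ) : Set where
  field
    n     : ℕ
    part  : Fin n → Fin r
    edges : List (Subset n)

open PartHypergraph public

ExactlyOneIn : ∀ {r n} → (Fin n → Fin r) → Subset n → Fin r → Set
ExactlyOneIn {n = n} part e j =
  Σ (Fin n) λ v → (v ∈ e) × (part v ≡ j) ×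
    ((w : Fin n) → w ∈ e → part w ≡ j → w ≡ v)

-- r-uniform and r-partite w.r.t. the given partition
-- (r-uniformity follows from meeting each of the r classes exactly once)
IsRPartite : ∀ {r} → PartHypergraph r → Set
IsRPartite {r} H = ∀ e → e L.∈ edges H → (j : Fin r) → ExactlyOneIn (part H) e j

IsTIntersecting : ∀ {r} → ℕ → PartHypergraph r → Set
IsTIntersecting t H = ∀ e f → e L.∈ edges H → f L.∈ edges H → t ≤ ∣ e ∩ f ∣

IsRTGraph : (r t : ℕ) → PartHypergraph r → Set
IsRTGraph r t H = IsRPartite H × IsTIntersecting t H

IsCover : ∀ {r} (H : PartHypergraph r) → Subset (n H) → Set
IsCover H C = ∀ e → e L.∈ edges H → Nonempty (C ∩ e)

CoverNumberAtMost : ∀ {r} → PartHypergraph r → ℕ → Set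
CoverNumberAtMost H k = Σ (Subset (n H)) λ C → IsCover H C × (∣ C ∣ ≤ k)

module Submission where

-- In an r-partite hypergraph every edge e has exactly one vertex in each
-- class j; call it the vertex of e at j.  For two edges e₁, e₂ let J be the
-- set of classes where they share their vertex, so |J| = |e₁ ∩ e₂| = T.
-- For A ⊆ J and C disjoint from J, let K consist of the vertices of e₁ at
-- A ∪ C and of e₂ at C; then |K| ≤ |A| + 2|C|.  If an edge f missed K,
-- then at each class j the quantity [f,e₁ agree at j] + [f,e₂ agree at j]
-- + 2[j ∈ A] + [j ∈ C] is at most 1 + [j ∈ J]; summing over the r classes
-- and using |f ∩ eᵢ| ≥ t gives 2t + 2|A| + |C| ≤ r + T.  Hence K is a cover
-- as soon as r + T < 2t + 2|A| + |C| ("two-edge-cover").  The theorem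
-- follows by choosing |A| = ⌊(r−T)/2⌋ + T − t + 1, C = ∅ in the first case
-- and A = J, |C| = r − T − 2t + 1 in the second.
--
-- Counting is done with finite sums of 0/1 indicators; the bridge between
-- vertices and classes is that summing over the vertices of an edge is
-- summing over the classes.

open import Defs
open import Data.Nat using (ℕ; _+_; _*_; _∸_; _/_; _≤_)
open import Data.Fin.Subset using (Subset; _∩_; ∣_∣)
open import Data.List.Membership.Propositional using (_∈_)
open import Data.Product using (_×_)

open import Data.Nat using (zero; suc; _<_; z≤n; s≤s; >-nonZero)
open import Data.Nat.Properties
  using ( ≤-refl; ≤-reflexive; ≤-trans; ≤-pred; <⇒≱; module ≤-Reasoning
        ; +-comm; *-comm; +-identityʳ; +-mono-≤; +-monoˡ-≤; +-monoʳ-≤; *-monoˡ-≤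
        ; m≤m+n; m≤n+m∸n; m+n∸n≡m; m+[n∸m]≡n; m∸n+n≡m; m<n+o⇒m∸n<o
        ; +-*-semiring )
open import Data.Nat.DivMod using (_%_; m≡m%n+[m/n]*n; m%n<n; m<n*o⇒m/o<n)
open import Data.Nat.Tactic.RingSolver using (solve-∀)
open import Data.Bool using (Bool; true; false; _∧_; _∨_; not)
open import Data.Fin using (Fin; zero; suc; _≟_)
open import Data.Fin.Properties using (suc-injective)
open import Data.Fin.Subset.Properties using (nonempty?)
open import Data.Vec using ([]; _∷_; lookup; tabulate)
open import Data.Vec.Properties using (lookup-zipWith; lookup∘tabulate; []=⇒lookup; lookup⇒[]=)
open import Data.Product using (∃-syntax; _,_; proj₁; proj₂)
open import Function using (_∘_)
open import Relation.Binary.PropositionalEquality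
  using (_≡_; refl; sym; trans; cong; cong₂; subst; subst₂; module ≡-Reasoning)
open import Relation.Nullary using (¬_; yes; no; does; contradiction)
open import Relation.Nullary.Decidable using (dec-true; dec-false)
open import Algebra.Properties.Semiring.Sum +-*-semiring
  using (sum; sum-cong-≗; sum-replicate-zero; ∑-distrib-+; ∑-comm)

⟦_⟧ : Bool → ℕ
⟦ true ⟧  = 1
⟦ false ⟧ = 0

infix 10 #_
#_ : ∀ {k} → (Fin k → Bool) → ℕ
# p = sum (⟦_⟧ ∘ p)

_⊆ᵇ_ : ∀ {k} → (Fin k → Bool) → (Fin k → Bool) → Set
p ⊆ᵇ q = ∀ j → p j ≡ true → q j ≡ true

⟦∨⟧≤ : ∀ a b → ⟦ a ∨ b ⟧ ≤ ⟦ a ⟧ + ⟦ b ⟧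
⟦∨⟧≤ true  b = s≤s z≤n
⟦∨⟧≤ false b = ≤-refl

⟦not⟧+⟦⟧≡1 : ∀ b → ⟦ not b ⟧ + ⟦ b ⟧ ≡ 1
⟦not⟧+⟦⟧≡1 true  = refl
⟦not⟧+⟦⟧≡1 false = refl

sum-mono-≤ : ∀ {k} {f g : Fin k → ℕ} → (∀ i → f i ≤ g i) → sum f ≤ sum g
sum-mono-≤ {zero}  f≤g = z≤n
sum-mono-≤ {suc k} f≤g = +-mono-≤ (f≤g zero) (sum-mono-≤ (f≤g ∘ suc))

sum-ones : ∀ k → sum {k} (λ _ → 1) ≡ k
sum-ones zero    = refl
sum-ones (suc k) = cong suc (sum-ones k)

sum-point : ∀ {k} (f : Fin k → ℕ) (i : Fin k) → (∀ j → ¬ j ≡ i → f j ≡ 0) →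
            sum f ≡ f i
sum-point {suc k} f zero    off = begin
  f zero + sum (f ∘ suc)          ≡⟨ cong (f zero +_) (sum-cong-≗ (λ j → off (suc j) λ ())) ⟩
  f zero + sum {k} (λ _ → 0)      ≡⟨ cong (f zero +_) (sum-replicate-zero k) ⟩
  f zero + 0                      ≡⟨ +-identityʳ (f zero) ⟩
  f zero                          ∎
  where open ≡-Reasoning
sum-point {suc k} f (suc i) off =
  cong₂ _+_ (off zero λ ()) (sum-point (f ∘ suc) i λ j j≢i → off (suc j) (j≢i ∘ suc-injective))

sum-transversal : ∀ {N r} (P : Fin N → Fin r) (u : Fin r → Fin N) (f : Fin N → ℕ) →
  (∀ j → P (u j) ≡ j) → (∀ v → ¬ v ≡ u (P v) → f v ≡ 0) → sum f ≡ sum (f ∘ u)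
sum-transversal {r = r} P u f Pu≡ off = begin
  sum f                                     ≡⟨ sum-cong-≗ (λ v → sym (spread v)) ⟩
  sum (λ v → sum (λ j → δ (P v) j * f v))   ≡⟨ ∑-comm (λ v j → δ (P v) j * f v) ⟩
  sum (λ j → sum (λ v → δ (P v) j * f v))   ≡⟨ sum-cong-≗ fibre ⟩
  sum (f ∘ u)                               ∎
  where
  open ≡-Reasoning
  δ : Fin r → Fin r → ℕ
  δ i j = ⟦ does (i ≟ j) ⟧
  δ-diag : ∀ i → δ i i ≡ 1
  δ-diag i = cong ⟦_⟧ (dec-true (i ≟ i) refl)
  spread : ∀ v → sum (λ j → δ (P v) j * f v) ≡ f v
  spread v = trans (sum-point _ (P v) off-class)
                   (trans (cong (_* f v) (δ-diag (P v))) (+-identityʳ (f v)))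
    where
    off-class : ∀ j → ¬ j ≡ P v → δ (P v) j * f v ≡ 0
    off-class j j≢ rewrite dec-false (P v ≟ j) (j≢ ∘ sym) = refl
  -- The only vertex of class j where f may be nonzero is u j.
  fibre : ∀ j → sum (λ v → δ (P v) j * f v) ≡ f (u j)
  fibre j = trans (sum-point _ (u j) off-u)
                  (trans (cong (λ i → δ i j * f (u j)) (Pu≡ j))
                         (trans (cong (_* f (u j)) (δ-diag j)) (+-identityʳ (f (u j)))))
    where
    off-u : ∀ v → ¬ v ≡ u j → δ (P v) j * f v ≡ 0
    off-u v v≢ with P v ≟ j
    ... | no  _    = refl
    ... | yes refl = trans (+-identityʳ (f v)) (off v v≢)

∣p∣≡# : ∀ {k} (p : Subset k) → ∣ p ∣ ≡ # (lookup p)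
∣p∣≡# []          = refl
∣p∣≡# (true ∷ p)  = cong suc (∣p∣≡# p)
∣p∣≡# (false ∷ p) = ∣p∣≡# p

shrink : ∀ {k} (p : Fin k → Bool) m → m ≤ # p → ∃[ q ] (q ⊆ᵇ p × # q ≡ m)
shrink {zero}  p zero    _ = (λ ()) , (λ ()) , refl
shrink {suc k} p m m≤ with p zero in p₀
... | false with shrink (p ∘ suc) m m≤
...   | q , q⊆ , #q = (λ { zero → false ; (suc j) → q j })
                    , (λ { zero () ; (suc j) → q⊆ j }) , #q
shrink {suc k} p zero m≤ | true =
  (λ _ → false) , (λ _ ()) , sum-replicate-zero (suc k)
shrink {suc k} p (suc m) m≤ | true with shrink (p ∘ suc) m (≤-pred m≤)
... | q , q⊆ , #q = (λ { zero → true ; (suc j) → q j })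
                  , (λ { zero _ → p₀ ; (suc j) → q⊆ j }) , cong suc #q

-- The per-class inequality behind the covering argument.  At one class,
-- b₁, b₂ say whether the vertex of a missed edge f lies in e₁, e₂; a, c
-- say whether the class is in A, C; g says whether e₁, e₂ agree there.
-- The first hypothesis says that the vertex of f is not in the cover.
class-bound : ∀ b₁ b₂ a c g → (b₁ ∧ (a ∨ c)) ∨ (b₂ ∧ c) ≡ false →
  (a ≡ true → g ≡ true) → (c ≡ true → not g ≡ true) →
  (b₁ ≡ true → b₂ ≡ true → g ≡ true) → (g ≡ true → b₂ ≡ true → b₁ ≡ true) →
  ⟦ b₁ ⟧ + ⟦ b₂ ⟧ + (⟦ a ⟧ + ⟦ a ⟧ + ⟦ c ⟧) ≤ 1 + ⟦ g ⟧
class-bound _     _     _     true  true  _  _  c⊆ _    _      = contradiction (c⊆ refl) λ ()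
class-bound _     _     true  _     false _  a⊆ _  _    _      = contradiction (a⊆ refl) λ ()
class-bound true  _     true  _     true  () _  _  _    _
class-bound false true  true  _     true  _  _  _  _    shared = contradiction (shared refl refl) λ ()
class-bound false false true  false true  _  _  _  _    _      = ≤-refl
class-bound true  true  false false true  _  _  _  _    _      = ≤-refl
class-bound true  false false false true  _  _  _  _    _      = s≤s z≤n
class-bound false true  false false true  _  _  _  _    _      = s≤s z≤n
class-bound false false false false true  _  _  _  _    _      = z≤n
class-bound true  _     false true  false () _  _  _    _
class-bound false true  false true  false () _  _  _    _
class-bound false false false true  false _  _  _  _    _      = ≤-refl
class-bound true  true  false false false _  _  _  both _      = contradiction (both refl refl) λ ()
class-bound true  false false false false _  _  _  _    _      = ≤-refl
class-bound false true  false false false _  _  _  _    _      = ≤-refl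
class-bound false false false false false _  _  _  _    _      = z≤n

cover-weaken : ∀ {r} (H : PartHypergraph r) {k k′} → k ≤ k′ →
               CoverNumberAtMost H k → CoverNumberAtMost H k′
cover-weaken H k≤k′ (C , cover , ∣C∣≤k) = C , cover , ≤-trans ∣C∣≤k k≤k′

module Transversals {r : ℕ} (H : PartHypergraph r) (partite : IsRPartite H) where

  vertex : ∀ {e} → e ∈ edges H → Fin r → Fin (n H)
  vertex {e} e∈ j = proj₁ (partite e e∈ j)

  vertex-∈ : ∀ {e} (e∈ : e ∈ edges H) j → lookup e (vertex e∈ j) ≡ true
  vertex-∈ {e} e∈ j = []=⇒lookup (proj₁ (proj₂ (partite e e∈ j)))

  vertex-class : ∀ {e} (e∈ : e ∈ edges H) j → part H (vertex e∈ j) ≡ j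
  vertex-class {e} e∈ j = proj₁ (proj₂ (proj₂ (partite e e∈ j)))

  vertex-unique : ∀ {e} (e∈ : e ∈ edges H) {j} w →
                  lookup e w ≡ true → part H w ≡ j → w ≡ vertex e∈ j
  vertex-unique {e} e∈ {j} w w∈ wj =
    proj₂ (proj₂ (proj₂ (partite e e∈ j))) w (lookup⇒[]= w e w∈) wj

  count-in-edge : ∀ {e} (e∈ : e ∈ edges H) (X : Fin (n H) → Bool) →
                  # (λ v → lookup e v ∧ X v) ≡ # (X ∘ vertex e∈)
  count-in-edge {e} e∈ X =
    trans (sum-transversal (part H) (vertex e∈) (λ v → ⟦ lookup e v ∧ X v ⟧)
                           (vertex-class e∈) off)
          (sum-cong-≗ λ j → cong (λ b → ⟦ b ∧ X (vertex e∈ j) ⟧) (vertex-∈ e∈ j))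
    where
    off : ∀ v → ¬ v ≡ vertex e∈ (part H v) → ⟦ lookup e v ∧ X v ⟧ ≡ 0
    off v v≢ with lookup e v in v∈
    ... | false = refl
    ... | true  = contradiction (vertex-unique e∈ v v∈ refl) v≢

  count-classes : ∀ {e} (e∈ : e ∈ edges H) (Y : Fin r → Bool) →
                  # (λ v → lookup e v ∧ Y (part H v)) ≡ # Y
  count-classes e∈ Y = trans (count-in-edge e∈ (Y ∘ part H))
                             (sum-cong-≗ λ j → cong (⟦_⟧ ∘ Y) (vertex-class e∈ j))

  ∣∩∣≡#classes : ∀ {f} (f∈ : f ∈ edges H) (e : Subset (n H)) →
                 ∣ f ∩ e ∣ ≡ # (lookup e ∘ vertex f∈)
  ∣∩∣≡#classes {f} f∈ e = begin
    ∣ f ∩ e ∣                        ≡⟨ ∣p∣≡# (f ∩ e) ⟩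
    # (lookup (f ∩ e))               ≡⟨ sum-cong-≗ (λ v → cong ⟦_⟧ (lookup-zipWith _∧_ v f e)) ⟩
    # (λ v → lookup f v ∧ lookup e v) ≡⟨ count-in-edge f∈ (lookup e) ⟩
    # (lookup e ∘ vertex f∈)         ∎
    where open ≡-Reasoning

  module TwoEdges (t : ℕ) (intersecting : IsTIntersecting t H)
                  {e₁ e₂} (e₁∈ : e₁ ∈ edges H) (e₂∈ : e₂ ∈ edges H) where

    agree : Fin r → Bool
    agree j = lookup e₂ (vertex e₁∈ j)

    ∣e₁∩e₂∣≡#agree : ∣ e₁ ∩ e₂ ∣ ≡ # agree
    ∣e₁∩e₂∣≡#agree = ∣∩∣≡#classes e₁∈ e₂

    inCover : (A C : Fin r → Bool) → Fin (n H) → Bool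
    inCover A C v = (lookup e₁ v ∧ (A (part H v) ∨ C (part H v)))
                  ∨ (lookup e₂ v ∧ C (part H v))

    cover : (A C : Fin r → Bool) → Subset (n H)
    cover A C = tabulate (inCover A C)

    -- Each class of A ∪ C costs one vertex and each class of C one more.
    cover-size : ∀ A C → ∣ cover A C ∣ ≤ # A + 2 * # C
    cover-size A C = begin
      ∣ cover A C ∣
        ≡⟨ ∣p∣≡# (cover A C) ⟩
      # (lookup (cover A C))
        ≡⟨ sum-cong-≗ (cong ⟦_⟧ ∘ lookup∘tabulate (inCover A C)) ⟩
      # (inCover A C)
        ≤⟨ sum-mono-≤ (λ v → ⟦∨⟧≤ (in₁ v) (in₂ v)) ⟩
      sum (λ v → ⟦ in₁ v ⟧ + ⟦ in₂ v ⟧)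
        ≡⟨ ∑-distrib-+ (⟦_⟧ ∘ in₁) (⟦_⟧ ∘ in₂) ⟩
      # in₁ + # in₂
        ≡⟨ cong₂ _+_ (count-classes e₁∈ (λ j → A j ∨ C j)) (count-classes e₂∈ C) ⟩
      # (λ j → A j ∨ C j) + # C
        ≤⟨ +-monoˡ-≤ (# C) (sum-mono-≤ (λ j → ⟦∨⟧≤ (A j) (C j))) ⟩
      sum (λ j → ⟦ A j ⟧ + ⟦ C j ⟧) + # C
        ≡⟨ cong (_+ # C) (∑-distrib-+ (⟦_⟧ ∘ A) (⟦_⟧ ∘ C)) ⟩
      # A + # C + # C
        ≡⟨ regroup (# A) (# C) ⟩
      # A + 2 * # C ∎
      where
      open ≤-Reasoning
      in₁ in₂ : Fin (n H) → Bool
      in₁ v = lookup e₁ v ∧ (A (part H v) ∨ C (part H v))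
      in₂ v = lookup e₂ v ∧ C (part H v)
      regroup : ∀ a c → a + c + c ≡ a + 2 * c
      regroup = solve-∀

    -- Summing the per-class inequality over the classes: an edge missing
    -- the cover forces 2t + 2|A| + |C| ≤ r + |J|.
    missed-edge-bound : ∀ A C → A ⊆ᵇ agree → C ⊆ᵇ (not ∘ agree) →
      ∀ {f} (f∈ : f ∈ edges H) → (∀ j → lookup (cover A C) (vertex f∈ j) ≡ false) →
      2 * t + (2 * # A + # C) ≤ r + # agree
    missed-edge-bound A C A⊆ C⊆ {f} f∈ misses = begin
      2 * t + (2 * # A + # C)
        ≡⟨ unfold-doubles t (# A) (# C) ⟩
      t + t + (# A + # A + # C)
        ≤⟨ +-monoˡ-≤ _ (+-mono-≤ (meets e₁∈) (meets e₂∈)) ⟩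
      # b₁ + # b₂ + (# A + # A + # C)
        ≡⟨ sym (∑-distrib-+₅ (⟦_⟧ ∘ b₁) (⟦_⟧ ∘ b₂) (⟦_⟧ ∘ A) (⟦_⟧ ∘ C)) ⟩
      sum (λ j → ⟦ b₁ j ⟧ + ⟦ b₂ j ⟧ + (⟦ A j ⟧ + ⟦ A j ⟧ + ⟦ C j ⟧))
        ≤⟨ sum-mono-≤ per-class ⟩
      sum (λ j → 1 + ⟦ agree j ⟧)
        ≡⟨ ∑-distrib-+ (λ _ → 1) (⟦_⟧ ∘ agree) ⟩
      sum {r} (λ _ → 1) + # agree
        ≡⟨ cong (_+ # agree) (sum-ones r) ⟩
      r + # agree ∎
      where
      open ≤-Reasoning
      unfold-doubles : ∀ t a c → 2 * t + (2 * a + c) ≡ t + t + (a + a + c)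
      unfold-doubles = solve-∀
      w : Fin r → Fin (n H)
      w = vertex f∈
      b₁ b₂ : Fin r → Bool
      b₁ = lookup e₁ ∘ w
      b₂ = lookup e₂ ∘ w

      meets : ∀ {e} → e ∈ edges H → t ≤ # (lookup e ∘ w)
      meets {e} e∈ = subst (t ≤_) (∣∩∣≡#classes f∈ e) (intersecting f e f∈ e∈)

      ∑-distrib-+₅ : ∀ (x y a c : Fin r → ℕ) →
        sum (λ j → x j + y j + (a j + a j + c j)) ≡ sum x + sum y + (sum a + sum a + sum c)
      ∑-distrib-+₅ x y a c =
        trans (∑-distrib-+ (λ j → x j + y j) (λ j → a j + a j + c j))
              (cong₂ _+_ (∑-distrib-+ x y)
                         (trans (∑-distrib-+ (λ j → a j + a j) c)
                                (cong (_+ sum c) (∑-distrib-+ a a))))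

      avoids : ∀ j → (b₁ j ∧ (A j ∨ C j)) ∨ (b₂ j ∧ C j) ≡ false
      avoids j = subst (λ i → (b₁ j ∧ (A i ∨ C i)) ∨ (b₂ j ∧ C i) ≡ false)
                       (vertex-class f∈ j)
                       (trans (sym (lookup∘tabulate (inCover A C) (w j))) (misses j))

      both : ∀ j → b₁ j ≡ true → b₂ j ≡ true → agree j ≡ true
      both j in₁ in₂ =
        subst (λ v → lookup e₂ v ≡ true) (vertex-unique e₁∈ (w j) in₁ (vertex-class f∈ j)) in₂

      shared : ∀ j → agree j ≡ true → b₂ j ≡ true → b₁ j ≡ true
      shared j agrees in₂ = subst (λ v → lookup e₁ v ≡ true) (sym w≡u₁) (vertex-∈ e₁∈ j)
        where
        w≡u₁ : w j ≡ vertex e₁∈ j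
        w≡u₁ = trans (vertex-unique e₂∈ (w j) in₂ (vertex-class f∈ j))
                     (sym (vertex-unique e₂∈ (vertex e₁∈ j) agrees (vertex-class e₁∈ j)))

      per-class : ∀ j → ⟦ b₁ j ⟧ + ⟦ b₂ j ⟧ + (⟦ A j ⟧ + ⟦ A j ⟧ + ⟦ C j ⟧) ≤ 1 + ⟦ agree j ⟧
      per-class j = class-bound (b₁ j) (b₂ j) (A j) (C j) (agree j)
                                (avoids j) (A⊆ j) (C⊆ j) (both j) (shared j)

    cover-covers : ∀ A C → A ⊆ᵇ agree → C ⊆ᵇ (not ∘ agree) →
      r + # agree < 2 * t + (2 * # A + # C) → IsCover H (cover A C)
    cover-covers A C A⊆ C⊆ large f f∈ with nonempty? (cover A C ∩ f)
    ... | yes hit  = hit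
    ... | no  miss = contradiction (missed-edge-bound A C A⊆ C⊆ f∈ misses) (<⇒≱ large)
      where
      misses : ∀ j → lookup (cover A C) (vertex f∈ j) ≡ false
      misses j with lookup (cover A C) (vertex f∈ j) in hit
      ... | false = refl
      ... | true  = contradiction (vertex f∈ j , lookup⇒[]= (vertex f∈ j) (cover A C ∩ f) in∩) miss
        where
        in∩ : lookup (cover A C ∩ f) (vertex f∈ j) ≡ true
        in∩ = trans (lookup-zipWith _∧_ (vertex f∈ j) (cover A C) f)
                    (cong₂ _∧_ hit (vertex-∈ f∈ j))

    #disagree : r ∸ ∣ e₁ ∩ e₂ ∣ ≡ # (not ∘ agree)
    #disagree = begin
      r ∸ ∣ e₁ ∩ e₂ ∣                        ≡⟨ cong₂ _∸_ (sym total) ∣e₁∩e₂∣≡#agree ⟩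
      # (not ∘ agree) + # agree ∸ # agree    ≡⟨ m+n∸n≡m (# (not ∘ agree)) (# agree) ⟩
      # (not ∘ agree)                        ∎
      where
      open ≡-Reasoning
      total : # (not ∘ agree) + # agree ≡ r
      total = trans (sym (∑-distrib-+ (⟦_⟧ ∘ not ∘ agree) (⟦_⟧ ∘ agree)))
                    (trans (sum-cong-≗ (⟦not⟧+⟦⟧≡1 ∘ agree)) (sum-ones r))

    two-edge-cover : ∀ a c → a ≤ ∣ e₁ ∩ e₂ ∣ → c ≤ r ∸ ∣ e₁ ∩ e₂ ∣ →
      r + ∣ e₁ ∩ e₂ ∣ < 2 * t + (2 * a + c) → CoverNumberAtMost H (a + 2 * c)
    two-edge-cover a c a≤ c≤ large
      with shrink agree a (subst (a ≤_) ∣e₁∩e₂∣≡#agree a≤)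
         | shrink (not ∘ agree) c (subst (c ≤_) #disagree c≤)
    ... | A , A⊆ , refl | C , C⊆ , refl =
      cover A C
      , cover-covers A C A⊆ C⊆ (subst (λ T → r + T < _) ∣e₁∩e₂∣≡#agree large)
      , cover-size A C

≤2*half+1 : ∀ d → d ≤ 2 * (d / 2) + 1
≤2*half+1 d = begin
  d                  ≡⟨ m≡m%n+[m/n]*n d 2 ⟩
  d % 2 + d / 2 * 2  ≤⟨ +-monoˡ-≤ (d / 2 * 2) (≤-pred (m%n<n d 2)) ⟩
  1 + d / 2 * 2      ≡⟨ reorder (d / 2) ⟩
  2 * (d / 2) + 1    ∎
  where
  open ≤-Reasoning
  reorder : ∀ q → 1 + q * 2 ≡ 2 * q + 1
  reorder = solve-∀

module FirstCase (r T t : ℕ) (1≤t : 1 ≤ t) (t≤T : t ≤ T) (T-large : r + 1 ≤ T + 2 * t) where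

  q s a : ℕ
  q = (r ∸ T) / 2
  s = T ∸ t
  a = q + s + 1

  -- ⌊(r − T)/2⌋ < t because r − T < 2t (using t ≥ 1 when T > r).
  q<t : q < t
  q<t = m<n*o⇒m/o<n (m<n+o⇒m∸n<o r T {{>-nonZero t*2>0}} r<T+t*2)
    where
    t*2>0 : 0 < t * 2
    t*2>0 = ≤-trans (s≤s z≤n) (*-monoˡ-≤ 2 1≤t)
    r<T+t*2 : r < T + t * 2
    r<T+t*2 = subst₂ _≤_ (+-comm r 1) (cong (T +_) (*-comm 2 t)) T-large

  a≤T : a ≤ T
  a≤T = begin
    q + s + 1  ≡⟨ reorder q s ⟩
    suc q + s  ≤⟨ +-monoˡ-≤ s q<t ⟩
    t + s      ≡⟨ m+[n∸m]≡n t≤T ⟩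
    T          ∎
    where
    open ≤-Reasoning
    reorder : ∀ q s → q + s + 1 ≡ suc q + s
    reorder = solve-∀

  -- 2a ≥ (r − T − 1) + 2(T − t) + 2, so 2t + 2a > r + T.
  large : r + T < 2 * t + (2 * a + 0)
  large = begin
    suc (r + T)                          ≤⟨ s≤s (+-monoˡ-≤ T (m≤n+m∸n r T)) ⟩
    suc (T + (r ∸ T) + T)                ≤⟨ s≤s (+-monoˡ-≤ T (+-monoʳ-≤ T (≤2*half+1 (r ∸ T)))) ⟩
    suc (T + (2 * q + 1) + T)            ≡⟨ cong (λ T → suc (T + (2 * q + 1) + T)) (sym (m+[n∸m]≡n t≤T)) ⟩
    suc (t + s + (2 * q + 1) + (t + s))  ≡⟨ collect t s q ⟩
    2 * t + (2 * a + 0)                  ∎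
    where
    open ≤-Reasoning
    collect : ∀ t s q → suc (t + s + (2 * q + 1) + (t + s)) ≡ 2 * t + (2 * (q + s + 1) + 0)
    collect = solve-∀

module SecondCase (r T t : ℕ) (1≤t : 1 ≤ t) (T-small : T + 2 * t ≤ r) where

  x : ℕ
  x = r ∸ (T + 2 * t)

  r≡ : x + (T + 2 * t) ≡ r
  r≡ = m∸n+n≡m T-small

  c≤ : suc x ≤ r ∸ T
  c≤ = begin
    suc x                  ≡⟨ +-comm 1 x ⟩
    x + 1                  ≤⟨ +-monoʳ-≤ x (≤-trans 1≤t (m≤m+n t (t + 0))) ⟩
    x + 2 * t              ≡⟨ sym (m+n∸n≡m (x + 2 * t) T) ⟩
    x + 2 * t + T ∸ T      ≡⟨ cong (_∸ T) (trans (reorder x T t) r≡) ⟩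
    r ∸ T                  ∎
    where
    open ≤-Reasoning
    reorder : ∀ x T t → x + 2 * t + T ≡ x + (T + 2 * t)
    reorder = solve-∀

  large : r + T < 2 * t + (2 * T + suc x)
  large = ≤-reflexive (begin
    suc (r + T)                   ≡⟨ cong (λ r → suc (r + T)) (sym r≡) ⟩
    suc (x + (T + 2 * t) + T)     ≡⟨ collect x T t ⟩
    2 * t + (2 * T + suc x)       ∎)
    where
    open ≡-Reasoning
    collect : ∀ x T t → suc (x + (T + 2 * t) + T) ≡ 2 * t + (2 * T + suc x)
    collect = solve-∀

  size : T + 2 * suc x ≤ 2 * r + 2 ∸ (4 * t + T)
  size = ≤-reflexive (begin
    T + 2 * suc x                                   ≡⟨ sym (m+n∸n≡m (T + 2 * suc x) (4 * t + T)) ⟩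
    T + 2 * suc x + (4 * t + T) ∸ (4 * t + T)       ≡⟨ cong (_∸ (4 * t + T)) (collect x T t) ⟩
    2 * (x + (T + 2 * t)) + 2 ∸ (4 * t + T)         ≡⟨ cong (λ r → 2 * r + 2 ∸ (4 * t + T)) r≡ ⟩
    2 * r + 2 ∸ (4 * t + T)                         ∎)
    where
    open ≡-Reasoning
    collect : ∀ x T t → T + 2 * suc x + (4 * t + T) ≡ 2 * (x + (T + 2 * t)) + 2
    collect = solve-∀

lemma2p5 : (r t : ℕ) → 1 ≤ t → (H : PartHypergraph r) → IsRTGraph r t H →
    (e₁ e₂ : Subset (n H)) → e₁ ∈ edges H → e₂ ∈ edges H →
    (r + 1 ≤ ∣ e₁ ∩ e₂ ∣ + 2 * t →
      CoverNumberAtMost H ((r ∸ ∣ e₁ ∩ e₂ ∣) / 2 + (∣ e₁ ∩ e₂ ∣ ∸ t) + 1))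
    × (∣ e₁ ∩ e₂ ∣ + 2 * t ≤ r →
      CoverNumberAtMost H (2 * r + 2 ∸ (4 * t + ∣ e₁ ∩ e₂ ∣)))
lemma2p5 r t 1≤t H (partite , intersecting) e₁ e₂ e₁∈ e₂∈ = first , second
  where
  open Transversals H partite
  open TwoEdges t intersecting e₁∈ e₂∈
  T : ℕ
  T = ∣ e₁ ∩ e₂ ∣

  first : r + 1 ≤ T + 2 * t → CoverNumberAtMost H ((r ∸ T) / 2 + (T ∸ t) + 1)
  first T-large = cover-weaken H (≤-reflexive (+-identityʳ a))
                               (two-edge-cover a 0 a≤T z≤n large)
    where open FirstCase r T t 1≤t (intersecting e₁ e₂ e₁∈ e₂∈) T-large

  second : T + 2 * t ≤ r → CoverNumberAtMost H (2 * r + 2 ∸ (4 * t + T))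
  second T-small = cover-weaken H size (two-edge-cover T (suc x) ≤-refl c≤ large)
    where open SecondCase r T t 1≤t T-small
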